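{- For every finite rack $R$, the lattice $\mathcal{R}(R)$ of subracks of $R$ is complemented: for every subrack $Q$ of $R$ there is a subrack $Q'$ of $R$ with $Q\cap Q'=\emptyset$ and $\ll Q\cup Q'\gg=R$.
   Context: A rack is a set $R$ with a binary operation $\triangleright$ such that $a\triangleright(b\triangleright c)=(a\triangleright b)\triangleright(a\triangleright c)$ for all $a,b,c\in R$, and for all $a,b\in R$ there is a unique $x\in R$ with $a\triangleright x=b$. A subrack is a subset $Q\subseteq R$ such that $(Q,\triangleright)$ is a rack (the empty set is a subrack). For $S\subseteq R$, $\ll S\gg$ is the intersection of all subracks containing $S$. $\mathcal{R}(R)$ is the lattice of subracks ordered by inclusion, with meet the intersection and join $\ll Q\cup Q'\gg$, bottom $\emptyset$ and top $R$. -}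

module Defs where

open import Data.Nat using (ℕ)
open import Data.Fin using (Fin)
open import Data.Fin.Subset using (Subset; _∈_; _⊆_)
open import Data.Product using (Σ; _×_)
open import Relation.Binary.PropositionalEquality using (_≡_)

-- A finite rack: carrier Fin n (any finite set is in bijection with some Fin n).
record Rack (n : ℕ) : Set where
  field
    _▷_      : Fin n → Fin n → Fin n
    selfdist : ∀ a b c → a ▷ (b ▷ c) ≡ (a ▷ b) ▷ (a ▷ c)
    solve    : ∀ a b → Σ (Fin n) λ x → (a ▷ x ≡ b) × (∀ y → a ▷ y ≡ b → y ≡ x)

module _ {n : ℕ} (R : Rack n) where
  open Rack R

  -- Q is a subrack: (Q, ▷) is a rack, i.e. ▷ restricts to Q, and for all a b ∈ Q
  -- there is a unique x ∈ Q with a ▷ x ≡ b (self-distributivity is inherited).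
  IsSubrack : Subset n → Set
  IsSubrack Q =
    (∀ {a b} → a ∈ Q → b ∈ Q → (a ▷ b) ∈ Q) ×
    (∀ {a b} → a ∈ Q → b ∈ Q →
      Σ (Fin n) λ x → (x ∈ Q) × (a ▷ x ≡ b) × (∀ y → y ∈ Q → a ▷ y ≡ b → y ≡ x))

  _∈≪_≫ : Fin n → Subset n → Set
  x ∈≪ S ≫ = ∀ (P : Subset n) → IsSubrack P → S ⊆ P → x ∈ P

module Submission where

-- Key fact (a Frattini argument): in a finite rack every element y of a subrack M
-- is avoided by some maximal proper subrack of M.  Indeed, each left translation
-- a ▷ _ with a ∈ M is an automorphism stabilising M, so it permutes the maximal
-- subracks of M and preserves their intersection Φ(M).  Hence the set M ∖ Φ(M) is a
-- subrack; if y ∈ Φ(M) it is proper, and a maximal subrack N above it must contain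
-- all of M, because elements of Φ(M) lie in every maximal subrack.  So Φ(M) = ∅.
--
-- The complement of Q is then any ⊆-minimal subrack Q′ such that Q ∪ Q′ generates R
-- (R itself is such a subrack).  If y ∈ Q ∩ Q′, a maximal subrack N of Q′ avoiding y
-- still has Q ∪ N generating R, contradicting minimality of Q′.

open import Defs
open import Data.Nat using (ℕ)
open import Data.Fin using (Fin)
open import Data.Fin.Properties using (all?; any?)
open import Data.Fin.Subset using (Subset; _∩_; _∪_; ⊥; ⊤; _∈_; _∉_; _⊆_; _⊂_; _⊃_)
open import Data.Fin.Subset.Properties
  using (_∈?_; _⊆?_; _⊂?_; anySubset?; ⊆-trans; p⊂q⇒p⊆q; ∈⊤; Empty-unique;
         x∈p∩q⁺; x∈p∩q⁻; x∈p∪q⁺; x∈p∪q⁻)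
open import Data.Fin.Subset.Induction using (⊂-wellFounded; ⊃-wellFounded)
open import Data.Vec using (tabulate)
open import Data.Vec.Properties using (lookup∘tabulate; lookup⇒[]=; []=⇒lookup)
open import Data.Bool using (true)
open import Data.Product using (Σ; ∃; _×_; _,_; proj₁; proj₂; swap)
open import Data.Sum using (inj₁; inj₂)
open import Function using (id)
open import Induction.WellFounded using (Acc; acc)
open import Relation.Nullary using (¬_; Dec; yes; no; does; proof; contradiction)
open import Relation.Nullary.Reflects using (Reflects; invert)
open import Relation.Nullary.Decidable using (_×-dec_; _→-dec_; ¬?; decidable-stable; dec-true)
open import Relation.Binary.PropositionalEquality
  using (_≡_; refl; sym; trans; cong; cong₂; subst; module ≡-Reasoning)

module FiniteSubsets {n : ℕ} where

  select : {P : Fin n → Set} → (∀ x → Dec (P x)) → Subset n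
  select P? = tabulate (λ x → does (P? x))

  ∈-select⁺ : {P : Fin n → Set} (P? : ∀ x → Dec (P x)) {x : Fin n} → P x → x ∈ select P?
  ∈-select⁺ P? {x} p =
    lookup⇒[]= x (select P?) (trans (lookup∘tabulate (λ x → does (P? x)) x) (dec-true (P? x) p))

  ∈-select⁻ : {P : Fin n → Set} (P? : ∀ x → Dec (P x)) {x : Fin n} → x ∈ select P? → P x
  ∈-select⁻ P? {x} x∈ = invert (subst (Reflects _) does≡true (proof (P? x)))
    where
    does≡true : does (P? x) ≡ true
    does≡true = trans (sym (lookup∘tabulate (λ x → does (P? x)) x)) ([]=⇒lookup x∈)

  ⊈-witness : {p q : Subset n} → ¬ (p ⊆ q) → ∃ λ x → x ∈ p × x ∉ q
  ⊈-witness {p} {q} p⊈q with any? (λ x → (x ∈? p) ×-dec ¬? (x ∈? q))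
  ... | yes witness = witness
  ... | no none =
    contradiction (λ {x} x∈p → decidable-stable (x ∈? q) λ x∉q → none (x , x∈p , x∉q)) p⊈q

  opaque
    ∀-subset? : {A : Subset n → Set} → (∀ P → Dec (A P)) → Dec (∀ P → A P)
    ∀-subset? A? with anySubset? (λ P → ¬? (A? P))
    ... | yes (P , ¬AP) = no λ all → ¬AP (all P)
    ... | no none = yes λ P → decidable-stable (A? P) λ ¬AP → none (P , ¬AP)

  IsMaximal : (Subset n → Set) → Subset n → Set
  IsMaximal A N = A N × (∀ P → A P → N ⊆ P → P ⊆ N)

  IsMinimal : (Subset n → Set) → Subset n → Set
  IsMinimal A N = A N × (∀ P → A P → P ⊆ N → N ⊆ P)

  opaque
    isMaximal? : {A : Subset n → Set} → (∀ P → Dec (A P)) → ∀ N → Dec (IsMaximal A N)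
    isMaximal? A? N = A? N ×-dec ∀-subset? (λ P → A? P →-dec ((N ⊆? P) →-dec (P ⊆? N)))

  maximal-above : {A : Subset n → Set} → (∀ P → Dec (A P)) →
                  ∀ {C} → A C → ∃ λ N → IsMaximal A N × C ⊆ N
  maximal-above {A} A? {C} = climb C (⊃-wellFounded C)
    where
    climb : ∀ C → Acc _⊃_ C → A C → ∃ λ N → IsMaximal A N × C ⊆ N
    climb C (acc larger) AC with anySubset? (λ P → A? P ×-dec (C ⊂? P))
    ... | yes (P , AP , C⊂P) =
      let (N , maxN , P⊆N) = climb P (larger C⊂P) AP in N , maxN , ⊆-trans (p⊂q⇒p⊆q C⊂P) P⊆N
    ... | no none = C , (AC , maximal) , id
      where
      maximal : ∀ P → A P → C ⊆ P → P ⊆ C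
      maximal P AP C⊆P with P ⊆? C
      ... | yes P⊆C = P⊆C
      ... | no P⊈C = contradiction (P , AP , (λ {x} → C⊆P {x}) , ⊈-witness P⊈C) none

  minimal-below : {A : Subset n → Set} → (∀ P → Dec (A P)) →
                  ∀ {C} → A C → ∃ λ N → IsMinimal A N × N ⊆ C
  minimal-below {A} A? {C} = descend C (⊂-wellFounded C)
    where
    descend : ∀ C → Acc _⊂_ C → A C → ∃ λ N → IsMinimal A N × N ⊆ C
    descend C (acc smaller) AC with anySubset? (λ P → A? P ×-dec (P ⊂? C))
    ... | yes (P , AP , P⊂C) =
      let (N , minN , N⊆P) = descend P (smaller P⊂C) AP in N , minN , ⊆-trans N⊆P (p⊂q⇒p⊆q P⊂C)
    ... | no none = C , (AC , minimal) , id
      where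
      minimal : ∀ P → A P → P ⊆ C → C ⊆ P
      minimal P AP P⊆C with C ⊆? P
      ... | yes C⊆P = C⊆P
      ... | no C⊈P = contradiction (P , AP , (λ {x} → P⊆C {x}) , ⊈-witness C⊈P) none

open FiniteSubsets

module RackTheory {n : ℕ} (R : Rack n) where
  open Rack R

  _◁_ : Fin n → Fin n → Fin n
  a ◁ b = proj₁ (solve a b)

  ▷-◁ : ∀ a b → a ▷ (a ◁ b) ≡ b
  ▷-◁ a b = proj₁ (proj₂ (solve a b))

  ◁-unique : ∀ a b y → a ▷ y ≡ b → y ≡ a ◁ b
  ◁-unique a b = proj₂ (proj₂ (solve a b))

  ◁-▷ : ∀ a b → a ◁ (a ▷ b) ≡ b
  ◁-▷ a b = sym (◁-unique a (a ▷ b) b refl)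

  -- Subsets closed under both rack operations.  These are exactly the subracks:
  -- closure under ◁ is existence of solutions inside the subset.
  Closed : Subset n → Set
  Closed P = ∀ a b → a ∈ P → b ∈ P → (a ▷ b ∈ P) × (a ◁ b ∈ P)

  opaque
    closed? : ∀ P → Dec (Closed P)
    closed? P = all? λ a → all? λ b →
      (a ∈? P) →-dec ((b ∈? P) →-dec ((a ▷ b ∈? P) ×-dec (a ◁ b ∈? P)))

  subrack⇒closed : ∀ {P} → IsSubrack R P → Closed P
  subrack⇒closed (▷-closed , solvable) a b a∈P b∈P =
    let (x , x∈P , a▷x≡b , _) = solvable a∈P b∈P in
    ▷-closed a∈P b∈P , subst (_∈ _) (◁-unique a b x a▷x≡b) x∈P

  closed⇒subrack : ∀ {P} → Closed P → IsSubrack R P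
  closed⇒subrack closed =
    (λ {a} {b} a∈P b∈P → proj₁ (closed a b a∈P b∈P)) ,
    λ {a} {b} a∈P b∈P → a ◁ b , proj₂ (closed a b a∈P b∈P) , ▷-◁ a b , λ y _ → ◁-unique a b y

  closed-∩ : ∀ P M → Closed P → Closed M → Closed (P ∩ M)
  closed-∩ P M closedP closedM a b a∈ b∈ =
    let (a∈P , a∈M) = x∈p∩q⁻ P M a∈ ; (b∈P , b∈M) = x∈p∩q⁻ P M b∈
        (ab∈P , a◁b∈P) = closedP a b a∈P b∈P ; (ab∈M , a◁b∈M) = closedM a b a∈M b∈M
    in x∈p∩q⁺ (ab∈P , ab∈M) , x∈p∩q⁺ (a◁b∈P , a◁b∈M)

  -- Automorphisms of R.  Preserving ▷ forces preserving ◁ as well.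
  record Automorphism : Set where
    field
      to from : Fin n → Fin n
      to-from : ∀ x → to (from x) ≡ x
      from-to : ∀ x → from (to x) ≡ x
      to-▷    : ∀ a b → to (a ▷ b) ≡ to a ▷ to b

    to-◁ : ∀ a b → to (a ◁ b) ≡ to a ◁ to b
    to-◁ a b = ◁-unique (to a) (to b) (to (a ◁ b))
      (trans (sym (to-▷ a (a ◁ b))) (cong to (▷-◁ a b)))

  open Automorphism

  inverse : Automorphism → Automorphism
  inverse h = record
    { to = from h ; from = to h ; to-from = from-to h ; from-to = to-from h ; to-▷ = from-▷ }
    where
    open ≡-Reasoning
    from-▷ : ∀ a b → from h (a ▷ b) ≡ from h a ▷ from h b
    from-▷ a b = begin
      from h (a ▷ b)
        ≡⟨ cong (from h) (cong₂ _▷_ (sym (to-from h a)) (sym (to-from h b))) ⟩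
      from h (to h (from h a) ▷ to h (from h b))
        ≡⟨ cong (from h) (sym (to-▷ h (from h a) (from h b))) ⟩
      from h (to h (from h a ▷ from h b))
        ≡⟨ from-to h (from h a ▷ from h b) ⟩
      from h a ▷ from h b
        ∎

  -- Left translation by a is an automorphism: this is what the rack axioms say.
  translation : Fin n → Automorphism
  translation a = record
    { to = a ▷_ ; from = a ◁_ ; to-from = ▷-◁ a ; from-to = ◁-▷ a ; to-▷ = selfdist a }

  Stabilises : Automorphism → Subset n → Set
  Stabilises h M = (∀ {x} → x ∈ M → to h x ∈ M) × (∀ {x} → x ∈ M → from h x ∈ M)

  inverse-stabilises : ∀ h {M} → Stabilises h M → Stabilises (inverse h) M
  inverse-stabilises _ = swap

  translation-stabilises : ∀ {a M} → Closed M → a ∈ M → Stabilises (translation a) M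
  translation-stabilises {a} closedM a∈M =
    (λ {x} x∈M → proj₁ (closedM a x a∈M x∈M)) , (λ {x} x∈M → proj₂ (closedM a x a∈M x∈M))

  _⁻¹[_] : Automorphism → Subset n → Subset n
  h ⁻¹[ N ] = select (λ u → to h u ∈? N)

  ∈-preimage⁺ : ∀ h N {x} → to h x ∈ N → x ∈ h ⁻¹[ N ]
  ∈-preimage⁺ h N = ∈-select⁺ (λ u → to h u ∈? N)

  ∈-preimage⁻ : ∀ h N {x} → x ∈ h ⁻¹[ N ] → to h x ∈ N
  ∈-preimage⁻ h N = ∈-select⁻ (λ u → to h u ∈? N)

  preimage-closed : ∀ h N → Closed N → Closed (h ⁻¹[ N ])
  preimage-closed h N closedN a b a∈ b∈ =
    let (ab∈N , a◁b∈N) = closedN (to h a) (to h b) (∈-preimage⁻ h N a∈) (∈-preimage⁻ h N b∈) in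
    ∈-preimage⁺ h N (subst (_∈ N) (sym (to-▷ h a b)) ab∈N) ,
    ∈-preimage⁺ h N (subst (_∈ N) (sym (to-◁ h a b)) a◁b∈N)

  ProperSubrack : Subset n → Subset n → Set
  ProperSubrack M P = Closed P × P ⊂ M

  opaque
    properSubrack? : ∀ M P → Dec (ProperSubrack M P)
    properSubrack? M P = closed? P ×-dec (P ⊂? M)

  Maximal : Subset n → Subset n → Set
  Maximal M = IsMaximal (ProperSubrack M)

  preimage-proper : ∀ h {M N} → Stabilises h M → ProperSubrack M N → ProperSubrack M (h ⁻¹[ N ])
  preimage-proper h {M} {N} (_ , from-M) (closedN , N⊆M , z , z∈M , z∉N) =
    preimage-closed h N closedN ,
    (λ {u} u∈ → subst (_∈ M) (from-to h u) (from-M (N⊆M (∈-preimage⁻ h N u∈)))) ,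
    from h z , from-M z∈M , λ fz∈ → z∉N (subst (_∈ N) (to-from h z) (∈-preimage⁻ h N fz∈))

  preimage-maximal : ∀ h {M N} → Stabilises h M → Maximal M N → Maximal M (h ⁻¹[ N ])
  preimage-maximal h {M} {N} stab (properN , maxN) = preimage-proper h stab properN , maximal
    where
    maximal : ∀ P → ProperSubrack M P → h ⁻¹[ N ] ⊆ P → P ⊆ h ⁻¹[ N ]
    maximal P properP h⁻¹N⊆P {u} u∈P = ∈-preimage⁺ h N (P′⊆N (∈-preimage⁺ h′ P u∈P′))
      where
      h′ = inverse h
      u∈P′ : from h (to h u) ∈ P
      u∈P′ = subst (_∈ P) (sym (from-to h u)) u∈P
      N⊆P′ : N ⊆ h′ ⁻¹[ P ]
      N⊆P′ {x} x∈N =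
        ∈-preimage⁺ h′ P (h⁻¹N⊆P (∈-preimage⁺ h N (subst (_∈ N) (sym (to-from h x)) x∈N)))
      P′⊆N : h′ ⁻¹[ P ] ⊆ N
      P′⊆N = maxN (h′ ⁻¹[ P ]) (preimage-proper h′ (inverse-stabilises h stab) properP) N⊆P′

  InFrattini : Subset n → Fin n → Set
  InFrattini M z = z ∈ M × (∀ N → Maximal M N → z ∈ N)

  opaque
    inFrattini? : ∀ M z → Dec (InFrattini M z)
    inFrattini? M z = (z ∈? M) ×-dec ∀-subset? (λ N → isMaximal? (properSubrack? M) N →-dec (z ∈? N))

  frattini-invariant : ∀ h {M z} → Stabilises h M → InFrattini M z → InFrattini M (to h z)
  frattini-invariant h stab (z∈M , z∈maximals) =
    proj₁ stab z∈M , λ N maxN → ∈-preimage⁻ h N (z∈maximals (h ⁻¹[ N ]) (preimage-maximal h stab maxN))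

  module Frattini {M : Subset n} (closedM : Closed M) where

    -- M ∖ Φ(M) is a subrack, because left translations in M preserve Φ(M).
    NonFrattini : Fin n → Set
    NonFrattini z = z ∈ M × ¬ InFrattini M z

    nonFrattini : Subset n
    nonFrattini = select (λ z → (z ∈? M) ×-dec ¬? (inFrattini? M z))

    ∈-nonFrattini⁺ : ∀ {z} → NonFrattini z → z ∈ nonFrattini
    ∈-nonFrattini⁺ = ∈-select⁺ (λ z → (z ∈? M) ×-dec ¬? (inFrattini? M z))

    ∈-nonFrattini⁻ : ∀ {z} → z ∈ nonFrattini → NonFrattini z
    ∈-nonFrattini⁻ = ∈-select⁻ (λ z → (z ∈? M) ×-dec ¬? (inFrattini? M z))

    nonFrattini-closed : Closed nonFrattini
    nonFrattini-closed a b a∈ b∈ =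
      let (a∈M , _) = ∈-nonFrattini⁻ a∈ ; (b∈M , b∉Φ) = ∈-nonFrattini⁻ b∈
          stab = translation-stabilises closedM a∈M
          (ab∈M , a◁b∈M) = closedM a b a∈M b∈M
      in ∈-nonFrattini⁺ (ab∈M , λ ab∈Φ → b∉Φ (subst (InFrattini M) (◁-▷ a b)
           (frattini-invariant (inverse (translation a)) (inverse-stabilises (translation a) stab) ab∈Φ))) ,
         ∈-nonFrattini⁺ (a◁b∈M , λ a◁b∈Φ →
           b∉Φ (subst (InFrattini M) (▷-◁ a b) (frattini-invariant (translation a) stab a◁b∈Φ)))

    -- A maximal subrack containing M ∖ Φ(M) contains Φ(M) too, hence all of M.
    maximal-above-nonFrattini : ∀ {N} → Maximal M N → nonFrattini ⊆ N → M ⊆ N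
    maximal-above-nonFrattini {N} maxN C⊆N {z} z∈M with inFrattini? M z
    ... | yes (_ , z∈maximals) = z∈maximals N maxN
    ... | no z∉Φ = C⊆N (∈-nonFrattini⁺ (z∈M , z∉Φ))

    -- Φ(M) is empty: if y ∈ Φ(M), then M ∖ Φ(M) is a proper subrack of M, and a
    -- maximal subrack above it would be all of M.
    frattini-empty : ∀ y → ¬ InFrattini M y
    frattini-empty y y∈Φ@(y∈M , _) =
      let (N , maxN , C⊆N) = maximal-above (properSubrack? M) properC
          (_ , _ , z , z∈M , z∉N) = proj₁ maxN
      in z∉N (maximal-above-nonFrattini maxN C⊆N z∈M)
      where
      properC : ProperSubrack M nonFrattini
      properC = nonFrattini-closed , (λ x∈C → proj₁ (∈-nonFrattini⁻ x∈C)) ,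
                y , y∈M , λ y∈C → proj₂ (∈-nonFrattini⁻ y∈C) y∈Φ

    avoided : ∀ {y} → y ∈ M → ∃ λ N → Maximal M N × y ∉ N
    avoided {y} y∈M with anySubset? (λ N → isMaximal? (properSubrack? M) N ×-dec ¬? (y ∈? N))
    ... | yes found = found
    ... | no none = contradiction
      (y∈M , λ N maxN → decidable-stable (y ∈? N) λ y∉N → none (N , maxN , y∉N)) (frattini-empty y)

  open Frattini using (avoided)

  Generates : Subset n → Set
  Generates S = ∀ P → Closed P → S ⊆ P → ∀ x → x ∈ P

  opaque
    generates? : ∀ S → Dec (Generates S)
    generates? S = ∀-subset? (λ P → closed? P →-dec ((S ⊆? P) →-dec all? (λ x → x ∈? P)))

  -- Replacing M by a maximal subrack N of M that avoids some y ∈ Q keeps Q ∪ _ generating: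
  -- a subrack P ⊇ Q ∪ N meets M in a subrack strictly above N, which must be M.
  generates-descend : ∀ {Q M N y} → Closed M → Generates (Q ∪ M) → y ∈ Q → y ∈ M →
                      Maximal M N → y ∉ N → Generates (Q ∪ N)
  generates-descend {Q} {M} {N} closedM genM y∈Q y∈M ((_ , N⊆M , _) , maxN) y∉N P closedP Q∪N⊆P
    with M ⊆? P
  ... | yes M⊆P = genM P closedP Q∪M⊆P
    where
    Q∪M⊆P : Q ∪ M ⊆ P
    Q∪M⊆P {x} x∈ with x∈p∪q⁻ Q M x∈
    ... | inj₁ x∈Q = Q∪N⊆P (x∈p∪q⁺ (inj₁ x∈Q))
    ... | inj₂ x∈M = M⊆P x∈M
  ... | no M⊈P = contradiction (P∩M⊆N (x∈p∩q⁺ (Q∪N⊆P (x∈p∪q⁺ (inj₁ y∈Q)) , y∈M))) y∉N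
    where
    N⊆P∩M : N ⊆ P ∩ M
    N⊆P∩M x∈N = x∈p∩q⁺ (Q∪N⊆P (x∈p∪q⁺ (inj₂ x∈N)) , N⊆M x∈N)
    properP∩M : ProperSubrack M (P ∩ M)
    properP∩M =
      let (x , x∈M , x∉P) = ⊈-witness M⊈P in
      closed-∩ P M closedP closedM , (λ x∈ → proj₂ (x∈p∩q⁻ P M x∈)) ,
      x , x∈M , λ x∈P∩M → x∉P (proj₁ (x∈p∩q⁻ P M x∈P∩M))
    P∩M⊆N : P ∩ M ⊆ N
    P∩M⊆N = maxN (P ∩ M) properP∩M N⊆P∩M

  Supplement : Subset n → Subset n → Set
  Supplement Q M = Closed M × Generates (Q ∪ M)

  supplement? : ∀ Q M → Dec (Supplement Q M)
  supplement? Q M = closed? M ×-dec generates? (Q ∪ M)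

  ⊤-supplement : ∀ Q → Supplement Q ⊤
  ⊤-supplement Q = (λ _ _ _ _ → ∈⊤ , ∈⊤) , λ P _ Q∪⊤⊆P x → Q∪⊤⊆P (x∈p∪q⁺ (inj₂ ∈⊤))

  -- A minimal supplement of Q is disjoint from Q, i.e. it is a complement: if y ∈ Q ∩ Q′,
  -- a maximal subrack of Q′ avoiding y would be a smaller supplement.
  minimal-supplement-disjoint : ∀ {Q Q′} → IsMinimal (Supplement Q) Q′ → Q ∩ Q′ ≡ ⊥
  minimal-supplement-disjoint {Q} {Q′} ((closedQ′ , genQ′) , minimal) =
    Empty-unique λ (y , y∈Q∩Q′) →
      let (y∈Q , y∈Q′) = x∈p∩q⁻ Q Q′ y∈Q∩Q′
          (N , maxN , y∉N) = avoided closedQ′ y∈Q′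
          ((closedN , N⊆Q′ , _) , _) = maxN
          N-supplement = closedN , generates-descend closedQ′ genQ′ y∈Q y∈Q′ maxN y∉N
      in y∉N (minimal N N-supplement (λ {x} → N⊆Q′ {x}) y∈Q′)

open RackTheory

-- Corollary 3.2: the subrack lattice of a finite rack is complemented.  The complement of Q
-- is a minimal supplement, found below the supplement R; Q need not even be a subrack.
corollary3p2 : (n : ℕ) (R : Rack n) (Q : Subset n) → IsSubrack R Q →
    Σ (Subset n) λ Q′ → IsSubrack R Q′ × (Q ∩ Q′ ≡ ⊥) × (∀ (x : Fin n) → _∈≪_≫ R x (Q ∪ Q′))
corollary3p2 n R Q _ =
  let (Q′ , minimal , _) = minimal-below (supplement? R Q) (⊤-supplement R Q)
      ((closedQ′ , genQ′) , _) = minimal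
  in Q′ , closed⇒subrack R closedQ′ , minimal-supplement-disjoint R minimal ,
     λ x P P-subrack Q∪Q′⊆P → genQ′ P (subrack⇒closed R P-subrack) Q∪Q′⊆P x
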